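{- Every bipartite permutation graph is Parikh word representable.
   Context: Let $\Sigma=\{a_1<a_2<\dots<a_s\}$ be a finite ordered alphabet and $w=w_1w_2\cdots w_n$ a nonempty word over $\Sigma$ with each $w_i\in\Sigma$. The Parikh graph $\mathcal{G}(w)$ of $w$ over $\Sigma$ is the simple undirected graph with vertex set $\{1,\dots,n\}$ in which, for $1\le i<j\le n$, the vertices $i$ and $j$ are adjacent if and only if $w_i=a_k$ and $w_j=a_{k+1}$ for some $1\le k\le s-1$. A graph $G$ is Parikh word representable if $G$ is isomorphic to $\mathcal{G}(w)$ for some nonempty word $w$ over some finite ordered alphabet. A graph $G=(V,E)$ (finite, simple) is a permutation graph if there is an ordering $v_1,\dots,v_n$ of $V$ and a permutation $\tau$ of $\{1,\dots,n\}$ such that for all $1\le i<j\le n$, $(v_i,v_j)\in E$ if and only if $\tau(i)>\tau(j)$. A bipartite permutation graph is a graph that is both bipartite and a permutation graph. -}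

module Defs where

open import Level using (0ℓ)
open import Data.Nat using (ℕ; suc; _<_)
open import Data.Fin using (Fin; toℕ)
open import Data.Bool using (Bool)
open import Data.Product using (Σ; _×_; ∃)
open import Data.Sum using (_⊎_)
open import Relation.Nullary using (¬_)
open import Relation.Binary.PropositionalEquality using (_≡_; _≢_)
open import Function.Bundles using (_↔_; Inverse; _⇔_)

record Graph : Set₁ where
  field
    size  : ℕ
    Adj   : Fin size → Fin size → Set
    sym   : ∀ {u v} → Adj u v → Adj v u
    irrefl : ∀ {u} → ¬ Adj u u
open Graph public

_≅_ : Graph → Graph → Set
G ≅ H = Σ (Fin (size G) ↔ Fin (size H)) λ f →
  ∀ u v → Adj G u v ⇔ Adj H (Inverse.to f u) (Inverse.to f v)

-- Ordered alphabet a₁ < … < aₛ is modelled by Fin s with its natural order;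
-- a word of length n is a function Fin n → Fin s.
Word : ℕ → ℕ → Set
Word s n = Fin n → Fin s

ParikhArc : ∀ {s n} → Word s n → Fin n → Fin n → Set
ParikhArc w i j = (toℕ i < toℕ j) × (toℕ (w j) ≡ suc (toℕ (w i)))

ParikhAdj : ∀ {s n} → Word s n → Fin n → Fin n → Set
ParikhAdj w i j = ParikhArc w i j ⊎ ParikhArc w j i

open import Data.Sum using (inj₁; inj₂)
open import Data.Product using (_,_)
open import Data.Nat.Properties using (<-irrefl)
open import Relation.Binary.PropositionalEquality using (refl)

private
  psym : ∀ {s n} (w : Word s n) {i j} → ParikhAdj w i j → ParikhAdj w j i
  psym w (inj₁ a) = inj₂ a
  psym w (inj₂ a) = inj₁ a

  pirr : ∀ {s n} (w : Word s n) {i} → ¬ ParikhAdj w i i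
  pirr w (inj₁ (lt , _)) = <-irrefl refl lt
  pirr w (inj₂ (lt , _)) = <-irrefl refl lt

ParikhGraph : ∀ {s n} → Word s n → Graph
ParikhGraph {s} {n} w = record
  { size = n ; Adj = ParikhAdj w ; sym = psym w ; irrefl = pirr w }

ParikhRepresentable : Graph → Set
ParikhRepresentable G =
  Σ ℕ λ s → Σ ℕ λ m → Σ (Word s (suc m)) λ w → G ≅ ParikhGraph w

Bipartite : Graph → Set
Bipartite G = Σ (Fin (size G) → Bool) λ c →
  ∀ u v → Adj G u v → c u ≢ c v

-- Permutation graph: an ordering v₁,…,vₙ of V (a bijection Fin n ↔ V) and a
-- permutation τ of Fin n such that for i < j, v_i ~ v_j iff τ(i) > τ(j).
PermutationGraph : Graph → Set
PermutationGraph G =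
  Σ (Fin (size G) ↔ Fin (size G)) λ v →
  Σ (Fin (size G) ↔ Fin (size G)) λ τ →
    ∀ i j → toℕ i < toℕ j →
      Adj G (Inverse.to v i) (Inverse.to v j) ⇔
        (toℕ (Inverse.to τ j) < toℕ (Inverse.to τ i))

BipartitePermutationGraph : Graph → Set
BipartitePermutationGraph G = Bipartite G × PermutationGraph G

-- Number the vertices by the ordering of a permutation representation and let
-- y be its permutation; the graph is then the inversion graph of y, and being
-- bipartite means y has no decreasing subsequence of length three.  Such a y
-- splits into its left-to-right maxima (high vertices) and the rest (low
-- vertices), both increasing, and every edge joins a high vertex to a low one
-- on its right.  Sending each vertex to its leftmost neighbour yields a
-- spanning forest whose edges alternate between high and low vertices.  The
-- word lists the vertices in the lexicographic order of their root-to-vertex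
-- paths (coded so that siblings appear right to left), and the letter of a
-- vertex is its depth, shifted by a block reserved for its tree.  The core
-- lemmas show that the two ends of every inversion lie in one tree at
-- consecutive depths, the shallower one first in path order, and conversely
-- that any such pair is an inversion; so edges are exactly the pairs of
-- positions i < j carrying consecutive letters.
module Submission where

open import Defs hiding (sym)
open import Level using (0ℓ)
open import Data.Nat as ℕ using (ℕ; zero; suc; _+_; _*_; _∸_; _≤_; _<_; z≤n; s≤s; _<?_)
import Data.Nat.Properties as ℕₚ
open import Data.Fin as Fin using (Fin; toℕ; fromℕ<)
import Data.Fin.Properties as Finₚ
open import Data.Fin.Subset using (Subset; _∈_; _∉_; ∣_∣)
open import Data.Fin.Subset.Properties using (p⊂q⇒∣p∣<∣q∣; ∣⊤∣≡n; ∈⊤)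
open import Data.Vec using (tabulate)
open import Data.Vec.Properties using (lookup∘tabulate; []=⇒lookup; lookup⇒[]=)
open import Data.List using (List; []; _∷_; _∷ʳ_; length)
open import Data.List.Properties using (length-++; ∷ʳ-injectiveʳ)
open import Data.List.Relation.Binary.Lex.Strict as Lex using (Lex-<; halt; this; next)
open import Data.List.Relation.Binary.Pointwise using (Pointwise; Pointwise-≡⇒≡; ≡⇒Pointwise-≡)
open import Data.Product using (Σ; ∃; _×_; _,_; proj₁; proj₂)
open import Data.Sum as Sum using (_⊎_; inj₁; inj₂)
open import Data.Bool using (Bool; true; false; not)
open import Data.Empty using (⊥; ⊥-elim)
open import Function using (_∘_)
open import Function.Bundles using (_↔_; Inverse; mk↔ₛ′; _⇔_; mk⇔; Equivalence)
open import Function.Construct.Composition using (_↔-∘_; _⇔-∘_)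
open import Function.Construct.Symmetry using (↔-sym)
open import Relation.Nullary using (¬_; Dec; yes; no; does; contradiction)
open import Relation.Nullary.Decidable using (dec-true; _×-dec_; _⊎-dec_; ¬?)
open import Relation.Binary using (Rel; IsStrictTotalOrder; Tri; tri<; tri≈; tri>)
open import Relation.Binary.PropositionalEquality as ≡
  using (_≡_; _≢_; refl; sym; trans; cong; cong₂; subst; subst₂)

injective⇒surjective : ∀ {m} (f : Fin m → Fin m) → (∀ {u v} → f u ≡ f v → u ≡ v) →
                       ∀ j → ∃ λ v → f v ≡ j
injective⇒surjective {suc m} f f-inj j with Finₚ.any? (λ v → f v Finₚ.≟ j)
... | yes hit = hit
... | no miss = ⊥-elim (ℕₚ.<-irrefl refl (Finₚ.injective⇒≤ punched-inj))
  where
  avoid : ∀ v → j ≢ f v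
  avoid v e = miss (v , sym e)
  punched-inj : ∀ {u v} → Fin.punchOut (avoid u) ≡ Fin.punchOut (avoid v) → u ≡ v
  punched-inj e = f-inj (Finₚ.punchOut-injective (avoid _) (avoid _) e)

leftmost : ∀ {n} (P : Fin n → Set) → (∀ i → Dec (P i)) →
  (Σ (Fin n) λ w → P w × (∀ w' → P w' → toℕ w ≤ toℕ w')) ⊎ (∀ w → ¬ P w)
leftmost {zero} P P? = inj₂ (λ ())
leftmost {suc n} P P? with P? Fin.zero
... | yes p = inj₁ (Fin.zero , p , λ _ _ → z≤n)
... | no ¬p with leftmost (λ i → P (Fin.suc i)) (λ i → P? (Fin.suc i))
...   | inj₁ (w , p , min) = inj₁ (Fin.suc w , p , λ { Fin.zero q → contradiction q ¬p
                                                   ; (Fin.suc w') q → s≤s (min w' q) })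
...   | inj₂ none = inj₂ (λ { Fin.zero q → ¬p q ; (Fin.suc w) q → none w q })

module Sorting {A : Set} {_≺_ : Rel A 0ℓ} (≺-sto : IsStrictTotalOrder _≡_ _≺_)
               {n : ℕ} (key : Fin n → A) (key-inj : ∀ {u v} → key u ≡ key v → u ≡ v) where

  open IsStrictTotalOrder ≺-sto using (compare) renaming (_<?_ to _≺?_; trans to ≺-trans; irrefl to ≺-irrefl)

  below : Fin n → Subset n
  below v = tabulate λ w → does (key w ≺? key v)

  ∈below : ∀ {v w} → key w ≺ key v → w ∈ below v
  ∈below {v} {w} lt = lookup⇒[]= w _ (trans (lookup∘tabulate _ w) (dec-true (key w ≺? key v) lt))

  ∈below⁻¹ : ∀ {v w} → w ∈ below v → key w ≺ key v
  ∈below⁻¹ {v} {w} w∈ with key w ≺? key v | trans (sym (lookup∘tabulate _ w)) ([]=⇒lookup w∈)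
  ... | yes lt | _  = lt
  ... | no _   | ()

  ∉below-self : ∀ v → v ∉ below v
  ∉below-self v v∈ = ≺-irrefl refl (∈below⁻¹ v∈)

  position : Fin n → ℕ
  position v = ∣ below v ∣

  position<n : ∀ v → position v < n
  position<n v = subst (position v <_) (∣⊤∣≡n n) (p⊂q⇒∣p∣<∣q∣ ((λ _ → ∈⊤) , v , ∈⊤ , ∉below-self v))

  position-mono : ∀ {u v} → key u ≺ key v → position u < position v
  position-mono {u} {v} lt = p⊂q⇒∣p∣<∣q∣
    ((λ w∈ → ∈below (≺-trans (∈below⁻¹ w∈) lt)) , u , ∈below lt , ∉below-self u)

  -- The sorting map itself; kept abstract so that its counting definition is
  -- never unfolded by the type checker.
  abstract
    σ : Fin n → Fin n
    σ v = fromℕ< (position<n v)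

    toℕ-σ : ∀ v → toℕ (σ v) ≡ position v
    toℕ-σ v = Finₚ.toℕ-fromℕ< (position<n v)

  σ-mono : ∀ {u v} → key u ≺ key v → toℕ (σ u) < toℕ (σ v)
  σ-mono {u} {v} lt rewrite toℕ-σ u | toℕ-σ v = position-mono lt

  σ-reflects : ∀ {u v} → toℕ (σ u) < toℕ (σ v) → key u ≺ key v
  σ-reflects {u} {v} lt with compare (key u) (key v)
  ... | tri< k< _ _ = k<
  ... | tri≈ _ k≡ _ rewrite key-inj k≡ = contradiction lt (ℕₚ.<-irrefl refl)
  ... | tri> _ _ k> = contradiction lt (ℕₚ.<-asym (σ-mono k>))

  σ-inj : ∀ {u v} → σ u ≡ σ v → u ≡ v
  σ-inj {u} {v} e with compare (key u) (key v)
  ... | tri< k< _ _ = contradiction (cong toℕ e) (ℕₚ.<⇒≢ (σ-mono k<))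
  ... | tri≈ _ k≡ _ = key-inj k≡
  ... | tri> _ _ k> = contradiction (cong toℕ (sym e)) (ℕₚ.<⇒≢ (σ-mono k>))

  σ↔ : Fin n ↔ Fin n
  σ↔ = mk↔ₛ′ σ σ⁻¹ (λ j → proj₂ (σ-onto j)) (λ v → σ-inj (proj₂ (σ-onto (σ v))))
    where
    σ-onto : ∀ j → ∃ λ v → σ v ≡ j
    σ-onto = injective⇒surjective σ σ-inj
    σ⁻¹ : Fin n → Fin n
    σ⁻¹ j = proj₁ (σ-onto j)

-- Strict lexicographic order on lists of naturals; a proper prefix is smaller.
infix 4 _<ₗ_
_<ₗ_ : Rel (List ℕ) 0ℓ
_<ₗ_ = Lex-< _≡_ _<_

<ₗ-isStrictTotalOrder : IsStrictTotalOrder _≡_ _<ₗ_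
<ₗ-isStrictTotalOrder = record
  { isStrictPartialOrder = record
    { isEquivalence = ≡.isEquivalence
    ; irrefl        = λ { refl → lex.irrefl (≡⇒Pointwise-≡ refl) }
    ; trans         = lex.trans
    ; <-resp-≈      = ≡.resp₂ _<ₗ_
    }
  ; compare = λ xs ys → pointwise⇒≡ (lex.compare xs ys)
  }
  where
  module lex = IsStrictTotalOrder (Lex.<-isStrictTotalOrder ℕₚ.<-isStrictTotalOrder)
  pointwise⇒≡ : ∀ {xs ys} → Tri (xs <ₗ ys) (Pointwise _≡_ xs ys) (ys <ₗ xs) →
                            Tri (xs <ₗ ys) (xs ≡ ys) (ys <ₗ xs)
  pointwise⇒≡ (tri< a ¬b ¬c) = tri< a (¬b ∘ ≡⇒Pointwise-≡) ¬c
  pointwise⇒≡ (tri≈ ¬a b ¬c) = tri≈ ¬a (Pointwise-≡⇒≡ b) ¬c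
  pointwise⇒≡ (tri> ¬a ¬b c) = tri> ¬a (¬b ∘ ≡⇒Pointwise-≡) c

<ₗ-∷ʳ : ∀ xs a → xs <ₗ xs ∷ʳ a
<ₗ-∷ʳ []       a = halt
<ₗ-∷ʳ (x ∷ xs) a = next refl (<ₗ-∷ʳ xs a)

∷ʳ-<ₗ-last : ∀ xs {a b} → a < b → xs ∷ʳ a <ₗ xs ∷ʳ b
∷ʳ-<ₗ-last []       a<b = this a<b
∷ʳ-<ₗ-last (x ∷ xs) a<b = next refl (∷ʳ-<ₗ-last xs a<b)

∷ʳ-<ₗ-mono : ∀ {xs ys} a b → length xs ≡ length ys → xs <ₗ ys → xs ∷ʳ a <ₗ ys ∷ʳ b
∷ʳ-<ₗ-mono a b ()  halt
∷ʳ-<ₗ-mono a b _   (this x<y)      = this x<y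
∷ʳ-<ₗ-mono a b len (next refl lt) = next refl (∷ʳ-<ₗ-mono a b (ℕₚ.suc-injective len) lt)

<ₗ-∷ʳ⁻¹ : ∀ {xs ys} b → length xs ≡ length ys → xs <ₗ ys ∷ʳ b → xs ≡ ys ⊎ xs <ₗ ys
<ₗ-∷ʳ⁻¹ {[]}     {[]}     b _   _ = inj₁ refl
<ₗ-∷ʳ⁻¹ {[]}     {_ ∷ _}  b _   _ = inj₂ halt
<ₗ-∷ʳ⁻¹ {_ ∷ _}  {[]}     b ()  _
<ₗ-∷ʳ⁻¹ {_ ∷ _}  {_ ∷ _}  b _   (this x<y) = inj₂ (this x<y)
<ₗ-∷ʳ⁻¹ {x ∷ xs} {_ ∷ ys} b len (next refl lt) with <ₗ-∷ʳ⁻¹ b (ℕₚ.suc-injective len) lt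
... | inj₁ refl = inj₁ refl
... | inj₂ lt′  = inj₂ (next refl lt′)

open IsStrictTotalOrder <ₗ-isStrictTotalOrder public
  using () renaming (asym to <ₗ-asym; trans to <ₗ-trans)

Inversion : ∀ {n} → (Fin n → ℕ) → Fin n → Fin n → Set
Inversion y u v = toℕ u < toℕ v × y v < y u

InversionAdj : ∀ {n} → (Fin n → ℕ) → Fin n → Fin n → Set
InversionAdj y u v = Inversion y u v ⊎ Inversion y v u

No321 : ∀ {n} → (Fin n → ℕ) → Set
No321 y = ∀ {u v w} → Inversion y u v → Inversion y v w → ⊥

differ-by-one : ∀ {p q} → q ≤ suc p → p ≤ suc q → p ≢ q → q ≡ suc p ⊎ p ≡ suc q
differ-by-one {p} {q} q≤1+p p≤1+q p≢q with ℕₚ.<-cmp p q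
... | tri< p<q _ _ = inj₁ (ℕₚ.≤-antisym q≤1+p p<q)
... | tri≈ _ p≡q _ = contradiction p≡q p≢q
... | tri> _ _ q<p = inj₂ (ℕₚ.≤-antisym p≤1+q q<p)

double-< : ∀ {p q} → p < q → suc (p + p) < q + q
double-< {p} lt = ℕₚ.≤-trans (s≤s (ℕₚ.≤-reflexive (sym (ℕₚ.+-suc p p)))) (ℕₚ.+-mono-≤ lt lt)

block-< : ∀ M {a b s t} → a < M → s < t → a + M * s < b + M * t
block-< M {a} {b} {s} {t} a<M s<t = ℕₚ.<-≤-trans (ℕₚ.+-monoˡ-< (M * s) a<M)
  (ℕₚ.≤-trans (ℕₚ.≤-reflexive (sym (ℕₚ.*-suc M s)))
    (ℕₚ.≤-trans (ℕₚ.*-monoʳ-≤ M s<t) (ℕₚ.m≤n+m (M * t) b)))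

successor-same-block : ∀ M {d d' r r'} → suc d < M → d' < M →
                       d' + M * r' ≡ suc (d + M * r) → r ≡ r'
successor-same-block M {r = r} {r'} 1+d<M d'<M e with ℕₚ.<-cmp r r'
... | tri≈ _ r≡r' _ = r≡r'
... | tri< r<r' _ _ = contradiction (sym e) (ℕₚ.<⇒≢ (block-< M 1+d<M r<r'))
... | tri> _ _ r'<r = contradiction e (ℕₚ.<⇒≢ (block-< M d'<M r'<r))

module InversionGraph {n : ℕ} (y : Fin n → ℕ) (y-inj : ∀ {u v} → y u ≡ y v → u ≡ v)
                      (no-321 : No321 y) where

  x : Fin n → ℕ
  x = toℕ

  x-inj : ∀ {u v} → x u ≡ x v → u ≡ v
  x-inj = Finₚ.toℕ-injective

  infix 4 _↘_ _~_
  _↘_ : Fin n → Fin n → Set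
  _↘_ = Inversion y

  _~_ : Fin n → Fin n → Set
  _~_ = InversionAdj y

  ~-sym : ∀ {u v} → u ~ v → v ~ u
  ~-sym (inj₁ i) = inj₂ i
  ~-sym (inj₂ i) = inj₁ i

  _↘?_ : ∀ u v → Dec (u ↘ v)
  u ↘? v = (x u <? x v) ×-dec (y v <? y u)

  _~?_ : ∀ u v → Dec (u ~ v)
  u ~? v = (u ↘? v) ⊎-dec (v ↘? u)

  -- Low vertices are the right ends of inversions; the others, the high
  -- vertices, are the left-to-right maxima of y.
  Low : Fin n → Set
  Low v = ∃ λ u → u ↘ v

  High : Fin n → Set
  High v = ¬ Low v

  low? : ∀ v → Dec (Low v)
  low? v = Finₚ.any? (λ u → u ↘? v)

  low-or-high : ∀ v → Low v ⊎ High v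
  low-or-high v with low? v
  ... | yes l = inj₁ l
  ... | no h = inj₂ h

  -- The left end of an inversion is high; otherwise y would contain 321.
  source-high : ∀ {u v} → u ↘ v → High u
  source-high u↘v (w , w↘u) = no-321 w↘u u↘v

  high-increasing : ∀ {a a'} → High a → High a' → x a < x a' → y a < y a'
  high-increasing {a} {a'} _ ha' lt with ℕₚ.<-cmp (y a) (y a')
  ... | tri< p _ _ = p
  ... | tri≈ _ e _ = contradiction (cong x (y-inj e)) (ℕₚ.<⇒≢ lt)
  ... | tri> _ _ p = contradiction (a , lt , p) ha'

  high-increasing≤ : ∀ {a a'} → High a → High a' → x a ≤ x a' → y a ≤ y a'
  high-increasing≤ ha ha' le with ℕₚ.m≤n⇒m<n∨m≡n le
  ... | inj₁ lt = ℕₚ.<⇒≤ (high-increasing ha ha' lt)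
  ... | inj₂ e rewrite x-inj e = ℕₚ.≤-refl

  high-increasing⁻¹ : ∀ {a a'} → High a → High a' → y a < y a' → x a < x a'
  high-increasing⁻¹ {a} {a'} ha ha' lt with ℕₚ.<-cmp (x a) (x a')
  ... | tri< p _ _ = p
  ... | tri≈ _ e _ = contradiction (cong y (x-inj e)) (ℕₚ.<⇒≢ lt)
  ... | tri> _ _ p = contradiction lt (ℕₚ.<-asym (high-increasing ha' ha p))

  low-increasing : ∀ {b b'} → Low b → Low b' → x b < x b' → y b < y b'
  low-increasing {b} {b'} lb _ lt with ℕₚ.<-cmp (y b) (y b')
  ... | tri< p _ _ = p
  ... | tri≈ _ e _ = contradiction (cong x (y-inj e)) (ℕₚ.<⇒≢ lt)
  ... | tri> _ _ p = contradiction lb (source-high (lt , p))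

  low-increasing≤ : ∀ {b b'} → Low b → Low b' → x b ≤ x b' → y b ≤ y b'
  low-increasing≤ lb lb' le with ℕₚ.m≤n⇒m<n∨m≡n le
  ... | inj₁ lt = ℕₚ.<⇒≤ (low-increasing lb lb' lt)
  ... | inj₂ e rewrite x-inj e = ℕₚ.≤-refl

  -- The parent of a vertex is its leftmost neighbour (itself if isolated).
  -- Following parents leads to a root; this defines a spanning forest.
  abstract
    parent : Fin n → Fin n
    parent v with leftmost (_~ v) (_~? v)
    ... | inj₁ (w , _) = w
    ... | inj₂ _ = v

    parent-adjacent : ∀ {v w} → w ~ v → parent v ~ v
    parent-adjacent {v} {w} w~v with leftmost (_~ v) (_~? v)
    ... | inj₁ (_ , p~v , _) = p~v
    ... | inj₂ none = contradiction w~v (none w)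

    parent-leftmost : ∀ {v} w → w ~ v → x (parent v) ≤ x w
    parent-leftmost {v} w w~v with leftmost (_~ v) (_~? v)
    ... | inj₁ (_ , _ , min) = min w w~v
    ... | inj₂ none = contradiction w~v (none w)

    parent-isolated : ∀ {v} → (∀ w → ¬ w ~ v) → parent v ≡ v
    parent-isolated {v} isolated with leftmost (_~ v) (_~? v)
    ... | inj₁ (w , w~v , _) = contradiction w~v (isolated w)
    ... | inj₂ _ = refl

  Root : Fin n → Set
  Root v = High v × parent (parent v) ≡ v

  root? : ∀ v → Dec (Root v)
  root? v = ¬? (low? v) ×-dec (parent (parent v) Finₚ.≟ v)

  root-or-not : ∀ v → Root v ⊎ ¬ Root v
  root-or-not v with root? v
  ... | yes r = inj₁ r
  ... | no ¬r = inj₂ ¬r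

  low-nonroot : ∀ {v} → Low v → ¬ Root v
  low-nonroot lv (hv , _) = hv lv

  nonroot-adjacent : ∀ {v} → ¬ Root v → ∃ λ w → w ~ v
  nonroot-adjacent {v} ¬r with low? v
  ... | yes (u , u↘v) = u , inj₁ u↘v
  ... | no hv with Finₚ.any? (_~? v)
  ...   | yes nbr = nbr
  ...   | no ¬nbr = contradiction (hv , trans (cong parent p≡v) p≡v) ¬r
    where
    p≡v : parent v ≡ v
    p≡v = parent-isolated (λ w w~v → ¬nbr (w , w~v))

  parent-of-low : ∀ {v} → Low v → parent v ↘ v
  parent-of-low (u , u↘v) with parent-adjacent (inj₁ u↘v)
  ... | inj₁ p↘v = p↘v
  ... | inj₂ v↘p = contradiction (u , u↘v) (source-high v↘p)

  parent-of-high : ∀ {v} → High v → ¬ Root v → v ↘ parent v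
  parent-of-high hv ¬r with parent-adjacent (proj₂ (nonroot-adjacent ¬r))
  ... | inj₁ p↘v = contradiction (_ , p↘v) hv
  ... | inj₂ v↘p = v↘p

  low-parent-high : ∀ {v} → Low v → High (parent v)
  low-parent-high lv = source-high (parent-of-low lv)

  high-parent-low : ∀ {v} → High v → ¬ Root v → Low (parent v)
  high-parent-low hv ¬r = _ , parent-of-high hv ¬r

  grandparent-left : ∀ {v} → High v → ¬ Root v → x (parent (parent v)) < x v
  grandparent-left hv ¬r = ℕₚ.≤∧≢⇒< (parent-leftmost _ (inj₁ (parent-of-high hv ¬r)))
                                     (λ e → ¬r (hv , x-inj e))

  -- A weight that strictly decreases from a non-root to its parent:
  -- 2·x(parent v) + 1 for low v and 2·x v for high v.
  abstract
    weight : Fin n → ℕ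
    weight v with low? v
    ... | yes _ = suc (x (parent v) + x (parent v))
    ... | no _ = x v + x v

    weight-low : ∀ {v} → Low v → weight v ≡ suc (x (parent v) + x (parent v))
    weight-low {v} lv with low? v
    ... | yes _ = refl
    ... | no hv = contradiction lv hv

    weight-high : ∀ {v} → High v → weight v ≡ x v + x v
    weight-high {v} hv with low? v
    ... | yes lv = contradiction lv hv
    ... | no _ = refl

  weight-parent< : ∀ {v} → ¬ Root v → weight (parent v) < weight v
  weight-parent< {v} ¬r with low-or-high v
  ... | inj₁ lv rewrite weight-high (low-parent-high lv) | weight-low lv = ℕₚ.≤-refl
  ... | inj₂ hv rewrite weight-low (high-parent-low hv ¬r) | weight-high hv =
        double-< (grandparent-left hv ¬r)

  weight<2n : ∀ v → weight v < n + n
  weight<2n v with low-or-high v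
  ... | inj₁ lv rewrite weight-low lv = double-< (Finₚ.toℕ<n (parent v))
  ... | inj₂ hv rewrite weight-high hv = ℕₚ.+-mono-< (Finₚ.toℕ<n v) (Finₚ.toℕ<n v)

  weight-induction : (P : Fin n → Set) → (∀ v → (∀ w → weight w < weight v → P w) → P v) → ∀ v → P v
  weight-induction P step v = bounded (suc (weight v)) v ℕₚ.≤-refl
    where
    bounded : ∀ k v → weight v < k → P v
    bounded zero    v ()
    bounded (suc k) v lt = step v (λ w lw → bounded k w (ℕₚ.<-≤-trans lw (ℕ.s≤s⁻¹ lt)))

  -- The chain of proper ancestors of v, nearest first, computed with
  -- fuel weight v + 1, which suffices by weight-parent<.
  abstract
    ancestorsWithin : ℕ → Fin n → List (Fin n)
    ancestorsWithin zero    v = []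
    ancestorsWithin (suc f) v with root? v
    ... | yes _ = []
    ... | no _ = parent v ∷ ancestorsWithin f (parent v)

    ancestorsWithin-enough : ∀ f g v → weight v < f → weight v < g →
                             ancestorsWithin f v ≡ ancestorsWithin g v
    ancestorsWithin-enough (suc f) (suc g) v lf lg with root? v
    ... | yes _ = refl
    ... | no ¬r = cong (parent v ∷_) (ancestorsWithin-enough f g (parent v)
          (ℕₚ.<-≤-trans (weight-parent< ¬r) (ℕ.s≤s⁻¹ lf))
          (ℕₚ.<-≤-trans (weight-parent< ¬r) (ℕ.s≤s⁻¹ lg)))

    ancestorsWithin-root : ∀ f {v} → Root v → ancestorsWithin (suc f) v ≡ []
    ancestorsWithin-root f {v} r with root? v
    ... | yes _ = refl
    ... | no ¬r = contradiction r ¬r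

    ancestorsWithin-nonroot : ∀ f {v} → ¬ Root v →
                              ancestorsWithin (suc f) v ≡ parent v ∷ ancestorsWithin f (parent v)
    ancestorsWithin-nonroot f {v} ¬r with root? v
    ... | yes r = contradiction r ¬r
    ... | no _ = refl

  ancestors : Fin n → List (Fin n)
  ancestors v = ancestorsWithin (suc (weight v)) v

  ancestors-root : ∀ {v} → Root v → ancestors v ≡ []
  ancestors-root {v} = ancestorsWithin-root (weight v)

  ancestors-nonroot : ∀ {v} → ¬ Root v → ancestors v ≡ parent v ∷ ancestors (parent v)
  ancestors-nonroot {v} ¬r = trans (ancestorsWithin-nonroot (weight v) ¬r) (cong (parent v ∷_)
    (ancestorsWithin-enough (weight v) (suc (weight (parent v))) (parent v) (weight-parent< ¬r) ℕₚ.≤-refl))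

  lastOr : Fin n → List (Fin n) → Fin n
  lastOr v []       = v
  lastOr v (w ∷ ws) = lastOr w ws

  code : Fin n → ℕ
  code v = n ∸ x v

  code-< : ∀ {u v} → x v < x u → code u < code v
  code-< {u} lt = ℕₚ.∸-monoʳ-< lt (ℕₚ.<⇒≤ (Finₚ.toℕ<n u))

  code-inj : ∀ {u v} → code u ≡ code v → u ≡ v
  code-inj {u} {v} e = x-inj (begin
    x u          ≡⟨ sym (ℕₚ.m∸[m∸n]≡n (ℕₚ.<⇒≤ (Finₚ.toℕ<n u))) ⟩
    n ∸ code u   ≡⟨ cong (n ∸_) e ⟩
    n ∸ code v   ≡⟨ ℕₚ.m∸[m∸n]≡n (ℕₚ.<⇒≤ (Finₚ.toℕ<n v)) ⟩
    x v          ∎)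
    where open ≡.≡-Reasoning

  pathThrough : Fin n → List (Fin n) → List ℕ
  pathThrough v []       = code v ∷ []
  pathThrough v (w ∷ ws) = pathThrough w ws ∷ʳ code v

  depth : Fin n → ℕ
  depth v = length (ancestors v)

  rootPos : Fin n → ℕ
  rootPos v = x (lastOr v (ancestors v))

  path : Fin n → List ℕ
  path v = pathThrough v (ancestors v)

  depth-root : ∀ {v} → Root v → depth v ≡ 0
  depth-root r rewrite ancestors-root r = refl

  depth-nonroot : ∀ {v} → ¬ Root v → depth v ≡ suc (depth (parent v))
  depth-nonroot ¬r rewrite ancestors-nonroot ¬r = refl

  rootPos-root : ∀ {v} → Root v → rootPos v ≡ x v
  rootPos-root r rewrite ancestors-root r = refl

  rootPos-nonroot : ∀ {v} → ¬ Root v → rootPos v ≡ rootPos (parent v)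
  rootPos-nonroot ¬r rewrite ancestors-nonroot ¬r = refl

  path-root : ∀ {v} → Root v → path v ≡ code v ∷ []
  path-root r rewrite ancestors-root r = refl

  path-nonroot : ∀ {v} → ¬ Root v → path v ≡ path (parent v) ∷ʳ code v
  path-nonroot ¬r rewrite ancestors-nonroot ¬r = refl

  path-length : ∀ v → length (path v) ≡ suc (depth v)
  path-length v = through (ancestors v)
    where
    through : ∀ {v} ws → length (pathThrough v ws) ≡ suc (length ws)
    through []       = refl
    through {v} (w ∷ ws) rewrite length-++ (pathThrough w ws) {code v ∷ []} | through {w} ws =
      ℕₚ.+-comm (suc (length ws)) 1

  -- A path ends with the code of its endpoint, so paths determine vertices.
  path-inj : ∀ {u v} → path u ≡ path v → u ≡ v
  path-inj {u} {v} e = code-inj (∷ʳ-injectiveʳ (init u (ancestors u)) (init v (ancestors v))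
                         (trans (sym (ends u (ancestors u))) (trans e (ends v (ancestors v)))))
    where
    init : Fin n → List (Fin n) → List ℕ
    init v []       = []
    init v (w ∷ ws) = pathThrough w ws
    ends : ∀ v ws → pathThrough v ws ≡ init v ws ∷ʳ code v
    ends v []       = refl
    ends v (w ∷ ws) = refl

  nonroot-of-depth : ∀ {v k} → depth v ≡ suc k → ¬ Root v
  nonroot-of-depth e r = contradiction (trans (sym (depth-root r)) e) (λ ())

  root-of-depth0 : ∀ {v} → depth v ≡ 0 → Root v
  root-of-depth0 {v} e with root-or-not v
  ... | inj₁ r = r
  ... | inj₂ ¬r = contradiction (trans (sym (depth-nonroot ¬r)) e) (λ ())

  -- Depths are below 2n, so letters of different trees never interfere.
  depth≤weight : ∀ v → depth v ≤ weight v
  depth≤weight = weight-induction _ step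
    where
    step : ∀ v → (∀ w → weight w < weight v → depth w ≤ weight w) → depth v ≤ weight v
    step v ih with root-or-not v
    ... | inj₁ r rewrite depth-root r = z≤n
    ... | inj₂ ¬r rewrite depth-nonroot ¬r =
          ℕₚ.≤-<-trans (ih (parent v) (weight-parent< ¬r)) (weight-parent< ¬r)

  depth<2n : ∀ v → depth v < n + n
  depth<2n v = ℕₚ.≤-<-trans (depth≤weight v) (weight<2n v)

  odd : ℕ → Bool
  odd zero    = false
  odd (suc k) = not (odd k)

  -- Tree edges join a low and a high vertex and roots are high, so the low
  -- vertices are exactly those at odd depth.
  depth-parity : ∀ v → (Low v → odd (depth v) ≡ true) × (High v → odd (depth v) ≡ false)
  depth-parity = weight-induction _ step
    where
    step : ∀ v → (∀ w → weight w < weight v →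
                   (Low w → odd (depth w) ≡ true) × (High w → odd (depth w) ≡ false)) →
           (Low v → odd (depth v) ≡ true) × (High v → odd (depth v) ≡ false)
    step v ih with root-or-not v
    ... | inj₁ r rewrite depth-root r = (λ lv → contradiction lv (proj₁ r)) , (λ _ → refl)
    ... | inj₂ ¬r rewrite depth-nonroot ¬r =
          (λ lv → cong not (proj₂ (ih (parent v) (weight-parent< ¬r)) (low-parent-high lv))) ,
          (λ hv → cong not (proj₁ (ih (parent v) (weight-parent< ¬r)) (high-parent-low hv ¬r)))

  low-at-same-depth : ∀ {u v} → depth u ≡ depth v → Low u → Low v
  low-at-same-depth {u} {v} e lu with low-or-high v
  ... | inj₁ lv = lv
  ... | inj₂ hv = contradiction
        (trans (sym (proj₁ (depth-parity u) lu)) (trans (cong odd e) (proj₂ (depth-parity v) hv)))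
        (λ ())

  low-below-high : ∀ {u v} → depth v ≡ suc (depth u) → High u → Low v
  low-below-high {u} {v} e hu with low-or-high v
  ... | inj₁ lv = lv
  ... | inj₂ hv = contradiction
        (trans (sym (proj₂ (depth-parity v) hv)) (trans (cong odd e) (cong not (proj₂ (depth-parity u) hu))))
        (λ ())

  high-below-low : ∀ {u v} → depth v ≡ suc (depth u) → Low u → High v
  high-below-low {u} {v} e lu lv = contradiction
    (trans (sym (proj₁ (depth-parity v) lv)) (trans (cong odd e) (cong not (proj₁ (depth-parity u) lu))))
    (λ ())

  low-parent-mono : ∀ {b b'} → Low b → Low b' → x b ≤ x b' → x (parent b) ≤ x (parent b')
  low-parent-mono {b} {b'} lb lb' le with x (parent b') <? x b
  ... | yes lt = parent-leftmost (parent b')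
        (inj₁ (lt , ℕₚ.≤-<-trans (low-increasing≤ lb lb' le) (proj₂ (parent-of-low lb'))))
  ... | no ¬lt = ℕₚ.≤-trans (ℕₚ.<⇒≤ (proj₁ (parent-of-low lb))) (ℕₚ.≮⇒≥ ¬lt)

  high-parent-mono : ∀ {a a'} → High a → High a' → ¬ Root a → ¬ Root a' →
                     x a ≤ x a' → x (parent a) ≤ x (parent a')
  high-parent-mono {a} {a'} ha ha' ¬ra ¬ra' le with x (parent a') <? x (parent a)
  ... | no ¬lt = ℕₚ.≮⇒≥ ¬lt
  ... | yes lt = contradiction lt (ℕₚ.≤⇒≯ (parent-leftmost (parent a') (inj₂ a↘p')))
    where
    a↘p' : a ↘ parent a'
    a↘p' = ℕₚ.≤-<-trans le (proj₁ (parent-of-high ha' ¬ra')) ,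
           ℕₚ.<-trans (low-increasing (high-parent-low ha' ¬ra') (high-parent-low ha ¬ra) lt)
                      (proj₂ (parent-of-high ha ¬ra))

  grandparent-mono : ∀ {a a'} → High a → High a' → ¬ Root a → ¬ Root a' →
                     x a ≤ x a' → x (parent (parent a)) ≤ x (parent (parent a'))
  grandparent-mono ha ha' ¬ra ¬ra' le =
    low-parent-mono (high-parent-low ha ¬ra) (high-parent-low ha' ¬ra') (high-parent-mono ha ha' ¬ra ¬ra' le)

  grandparent-high : ∀ {v} → High v → ¬ Root v → High (parent (parent v))
  grandparent-high hv ¬r = low-parent-high (high-parent-low hv ¬r)

  rootPos-grandparent : ∀ {v} → High v → ¬ Root v → rootPos v ≡ rootPos (parent (parent v))
  rootPos-grandparent hv ¬r =
    trans (rootPos-nonroot ¬r) (rootPos-nonroot (low-nonroot (high-parent-low hv ¬r)))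

  depth-grandparent : ∀ {v} → High v → ¬ Root v → depth v ≡ suc (suc (depth (parent (parent v))))
  depth-grandparent hv ¬r =
    trans (depth-nonroot ¬r) (cong suc (depth-nonroot (low-nonroot (high-parent-low hv ¬r))))

  weight-grandparent< : ∀ {v} → High v → ¬ Root v → weight (parent (parent v)) < weight v
  weight-grandparent< hv ¬r =
    ℕₚ.<-trans (weight-parent< (low-nonroot (high-parent-low hv ¬r))) (weight-parent< ¬r)

  rootPos≤x : ∀ v → rootPos v ≤ x v
  rootPos≤x = weight-induction _ step
    where
    step : ∀ v → (∀ w → weight w < weight v → rootPos w ≤ x w) → rootPos v ≤ x v
    step v ih with root-or-not v
    ... | inj₁ r rewrite rootPos-root r = ℕₚ.≤-refl
    ... | inj₂ ¬r with low-or-high v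
    ...   | inj₁ lv rewrite rootPos-nonroot ¬r =
            ℕₚ.≤-trans (ih (parent v) (weight-parent< ¬r)) (ℕₚ.<⇒≤ (proj₁ (parent-of-low lv)))
    ...   | inj₂ hv rewrite rootPos-grandparent hv ¬r =
            ℕₚ.≤-trans (ih _ (weight-grandparent< hv ¬r)) (ℕₚ.<⇒≤ (grandparent-left hv ¬r))

  -- A root is the parent of each of its neighbours: if parent b were left of
  -- the root r, it would be adjacent to parent r, whose leftmost neighbour is r.
  root-parent-of-neighbour : ∀ {r b} → Root r → r ↘ b → parent b ≡ r
  root-parent-of-neighbour {r} {b} (hr , pp≡r) r↘b with x (parent b) <? x r
  ... | no ¬lt = x-inj (ℕₚ.≤-antisym (parent-leftmost r (inj₁ r↘b)) (ℕₚ.≮⇒≥ ¬lt))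
  ... | yes lt = contradiction lt (ℕₚ.≤⇒≯ (subst (λ z → x z ≤ x (parent b)) pp≡r
                   (parent-leftmost (parent b) (inj₁ pb↘b₀))))
    where
    r↘b₀ : r ↘ parent r
    r↘b₀ with parent-adjacent {w = b} (inj₂ r↘b)
    ... | inj₁ b₀↘r = contradiction (_ , b₀↘r) hr
    ... | inj₂ r↘b₀ = r↘b₀
    lb₀ : Low (parent r)
    lb₀ = r , r↘b₀
    pb↘b₀ : parent b ↘ parent r
    pb↘b₀ = ℕₚ.<-trans lt (proj₁ r↘b₀) ,
            ℕₚ.≤-<-trans (low-increasing≤ lb₀ (r , r↘b) (parent-leftmost b (inj₂ r↘b)))
                         (proj₂ (parent-of-low (r , r↘b)))

  -- A root weakly left of a high non-root v is weakly left of its grandparent;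
  -- otherwise r ↘ parent v, making r the grandparent by the previous lemma.
  root-left-of-grandparent : ∀ {r v} → Root r → High v → ¬ Root v → x r ≤ x v →
                             x r ≤ x (parent (parent v))
  root-left-of-grandparent {r} {v} rr hv ¬rv le with x (parent (parent v)) <? x r
  ... | no ¬lt = ℕₚ.≮⇒≥ ¬lt
  ... | yes lt = contradiction (cong x (root-parent-of-neighbour rr r↘b)) (ℕₚ.<⇒≢ lt)
    where
    b : Fin n
    b = parent v
    lb : Low b
    lb = high-parent-low hv ¬rv
    r<v : x r < x v
    r<v = ℕₚ.≤∧≢⇒< le (λ e → ¬rv (subst Root (x-inj e) rr))
    r↘b : r ↘ b
    r↘b = ℕₚ.<-trans r<v (proj₁ (parent-of-high hv ¬rv)) ,
          ℕₚ.<-trans (proj₂ (parent-of-low lb)) (high-increasing (low-parent-high lb) (proj₁ rr) lt)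

  -- Roots are monotone in position: on high vertices (by induction, stepping
  -- to grandparents), and hence on low ones (stepping to parents).
  rootPos-mono-high : ∀ v u → High u → High v → x u ≤ x v → rootPos u ≤ rootPos v
  rootPos-mono-high = weight-induction _ step
    where
    step : ∀ v → (∀ w → weight w < weight v → ∀ u → High u → High w → x u ≤ x w → rootPos u ≤ rootPos w) →
           ∀ u → High u → High v → x u ≤ x v → rootPos u ≤ rootPos v
    step v ih u hu hv le with root-or-not v | root-or-not u
    ... | inj₁ rv | _ rewrite rootPos-root rv = ℕₚ.≤-trans (rootPos≤x u) le
    ... | inj₂ ¬rv | inj₁ ru rewrite rootPos-grandparent hv ¬rv =
          ih _ (weight-grandparent< hv ¬rv) u hu (grandparent-high hv ¬rv)
             (root-left-of-grandparent ru hv ¬rv le)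
    ... | inj₂ ¬rv | inj₂ ¬ru rewrite rootPos-grandparent hv ¬rv | rootPos-grandparent hu ¬ru =
          ih _ (weight-grandparent< hv ¬rv) _ (grandparent-high hu ¬ru) (grandparent-high hv ¬rv)
             (grandparent-mono hu hv ¬ru ¬rv le)

  rootPos-mono-low : ∀ {b b'} → Low b → Low b' → x b ≤ x b' → rootPos b ≤ rootPos b'
  rootPos-mono-low lb lb' le rewrite rootPos-nonroot (low-nonroot lb) | rootPos-nonroot (low-nonroot lb') =
    rootPos-mono-high _ _ (low-parent-high lb) (low-parent-high lb') (low-parent-mono lb lb' le)

  depth-mono-high : ∀ v u → High u → High v → x u ≤ x v → rootPos u ≡ rootPos v → depth u ≤ depth v
  depth-mono-high = weight-induction _ step
    where
    step : ∀ v → (∀ w → weight w < weight v → ∀ u → High u → High w → x u ≤ x w →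
                   rootPos u ≡ rootPos w → depth u ≤ depth w) →
           ∀ u → High u → High v → x u ≤ x v → rootPos u ≡ rootPos v → depth u ≤ depth v
    step v ih u hu hv le same with root-or-not u | root-or-not v
    ... | inj₁ ru | _ rewrite depth-root ru = z≤n
    ... | inj₂ ¬ru | inj₁ rv = contradiction (subst Root (sym (x-inj (ℕₚ.≤-antisym le v≤u))) rv) ¬ru
      where
      v≤u : x v ≤ x u
      v≤u = subst (_≤ x u) (trans same (rootPos-root rv)) (rootPos≤x u)
    ... | inj₂ ¬ru | inj₂ ¬rv rewrite depth-grandparent hu ¬ru | depth-grandparent hv ¬rv =
          s≤s (s≤s (ih _ (weight-grandparent< hv ¬rv) _ (grandparent-high hu ¬ru) (grandparent-high hv ¬rv)
            (grandparent-mono hu hv ¬ru ¬rv le)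
            (trans (sym (rootPos-grandparent hu ¬ru)) (trans same (rootPos-grandparent hv ¬rv)))))

  depth-mono-low : ∀ {b b'} → Low b → Low b' → x b ≤ x b' → rootPos b ≡ rootPos b' → depth b ≤ depth b'
  depth-mono-low lb lb' le same rewrite depth-nonroot (low-nonroot lb) | depth-nonroot (low-nonroot lb') =
    s≤s (depth-mono-high _ _ (low-parent-high lb) (low-parent-high lb') (low-parent-mono lb lb' le)
      (trans (sym (rootPos-nonroot (low-nonroot lb))) (trans same (rootPos-nonroot (low-nonroot lb')))))

  inversion-in-tree : ∀ {a b} → a ↘ b →
    rootPos a ≡ rootPos b × (depth b ≡ suc (depth a) ⊎ depth a ≡ suc (depth b))
  inversion-in-tree {a} {b} a↘b = same-root , differ-by-one db≤ da≤ depths-differ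
    where
    lb : Low b
    lb = a , a↘b
    ha : High a
    ha = source-high a↘b
    p : Fin n
    p = parent b
    hp : High p
    hp = low-parent-high lb
    p≤a : x p ≤ x a
    p≤a = parent-leftmost a (inj₁ a↘b)
    b₀≤b : x (parent a) ≤ x b
    b₀≤b = parent-leftmost b (inj₂ a↘b)
    root-b : rootPos b ≡ rootPos p
    root-b = rootPos-nonroot (low-nonroot lb)
    rb≤ra : rootPos b ≤ rootPos a
    rb≤ra = subst (_≤ rootPos a) (sym root-b) (rootPos-mono-high a p hp ha p≤a)
    ra≤rb : rootPos a ≤ rootPos b
    ra≤rb with root-or-not a
    ... | inj₁ ra = ℕₚ.≤-reflexive (trans (cong rootPos (sym (root-parent-of-neighbour ra a↘b))) (sym root-b))
    ... | inj₂ ¬ra = subst (_≤ rootPos b) (sym (rootPos-nonroot ¬ra))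
                       (rootPos-mono-low (high-parent-low ha ¬ra) lb b₀≤b)
    same-root : rootPos a ≡ rootPos b
    same-root = ℕₚ.≤-antisym ra≤rb rb≤ra
    depths-differ : depth a ≢ depth b
    depths-differ e = ha (low-at-same-depth (sym e) lb)
    db≤ : depth b ≤ suc (depth a)
    db≤ rewrite depth-nonroot (low-nonroot lb) =
      s≤s (depth-mono-high a p hp ha p≤a (trans (sym root-b) (sym same-root)))
    da≤ : depth a ≤ suc (depth b)
    da≤ with root-or-not a
    ... | inj₁ ra rewrite depth-root ra = z≤n
    ... | inj₂ ¬ra rewrite depth-nonroot ¬ra =
          s≤s (depth-mono-low (high-parent-low ha ¬ra) lb b₀≤b
                 (trans (sym (rootPos-nonroot ¬ra)) same-root))

  high-at-parent-depth-left : ∀ {u v} → Low v → High u → rootPos u ≡ rootPos v →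
                              depth u ≡ depth (parent v) → x u < x v
  high-at-parent-depth-left {u} {v} lv hu same du with x u <? x v
  ... | yes u<v = u<v
  ... | no u≮v with root-or-not u
  ...   | inj₁ ru = contradiction (ℕₚ.≤-<-trans (rootPos≤x v) v<u)
                                  (ℕₚ.<-irrefl (trans (sym same) (rootPos-root ru)))
    where
    v<u : x v < x u
    v<u = ℕₚ.≤∧≢⇒< (ℕₚ.≮⇒≥ u≮v) (λ e → hu (subst Low (x-inj e) lv))
  ...   | inj₂ ¬ru = contradiction dv≤db₀ (ℕₚ.<⇒≱ (begin-strict
      depth b₀                       <⟨ ℕₚ.n<1+n _ ⟩
      suc (depth b₀)                 ≡⟨ sym (depth-nonroot ¬ru) ⟩
      depth u                        ≡⟨ du ⟩
      depth (parent v)               <⟨ ℕₚ.≤-reflexive (sym (depth-nonroot (low-nonroot lv))) ⟩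
      depth v                        ∎))
    where
    open ℕₚ.≤-Reasoning
    b₀ : Fin n
    b₀ = parent u
    dv≤db₀ : depth v ≤ depth b₀
    dv≤db₀ = depth-mono-low lv (high-parent-low hu ¬ru)
               (ℕₚ.≤-trans (ℕₚ.≮⇒≥ u≮v) (ℕₚ.<⇒≤ (proj₁ (parent-of-high hu ¬ru))))
               (trans (sym same) (rootPos-nonroot ¬ru))

  low-at-parent-depth-below : ∀ {u v} → High v → ¬ Root v → Low u → rootPos u ≡ rootPos v →
                              depth u ≡ depth (parent v) → y u < y v
  low-at-parent-depth-below {u} {v} hv ¬rv lu same du with y u <? y v
  ... | yes u<v = u<v
  ... | no u≮v = contradiction dv≤da₀ (ℕₚ.<⇒≱ (begin-strict
      depth a₀                       <⟨ ℕₚ.n<1+n _ ⟩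
      suc (depth a₀)                 ≡⟨ sym (depth-nonroot (low-nonroot lu)) ⟩
      depth u                        ≡⟨ du ⟩
      depth (parent v)               <⟨ ℕₚ.≤-reflexive (sym (depth-nonroot ¬rv)) ⟩
      depth v                        ∎))
    where
    open ℕₚ.≤-Reasoning
    a₀ : Fin n
    a₀ = parent u
    v<u : y v < y u
    v<u = ℕₚ.≤∧≢⇒< (ℕₚ.≮⇒≥ u≮v) (λ e → hv (subst Low (y-inj (sym e)) lu))
    dv≤da₀ : depth v ≤ depth a₀
    dv≤da₀ = depth-mono-high a₀ v hv (low-parent-high lu)
               (ℕₚ.<⇒≤ (high-increasing⁻¹ hv (low-parent-high lu) (ℕₚ.<-trans v<u (proj₂ (parent-of-low lu)))))
               (trans (sym same) (rootPos-nonroot (low-nonroot lu)))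

  -- At a fixed depth, path order reverses position order: parents are
  -- weakly ordered the same way, and when they coincide the codes decide.
  path-antitone : ∀ k {u v} → depth u ≡ k → depth v ≡ k → x v < x u → path u <ₗ path v
  path-antitone zero {u} {v} du dv v<u =
    subst₂ _<ₗ_ (sym (path-root (root-of-depth0 du))) (sym (path-root (root-of-depth0 dv))) (this (code-< v<u))
  path-antitone (suc k) {u} {v} du dv v<u =
    subst₂ _<ₗ_ (sym (path-nonroot ¬ru)) (sym (path-nonroot ¬rv)) extended
    where
    ¬ru : ¬ Root u
    ¬ru = nonroot-of-depth du
    ¬rv : ¬ Root v
    ¬rv = nonroot-of-depth dv
    dpu : depth (parent u) ≡ k
    dpu = ℕₚ.suc-injective (trans (sym (depth-nonroot ¬ru)) du)
    dpv : depth (parent v) ≡ k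
    dpv = ℕₚ.suc-injective (trans (sym (depth-nonroot ¬rv)) dv)
    pv≤pu : x (parent v) ≤ x (parent u)
    pv≤pu with low-or-high u
    ... | inj₁ lu = low-parent-mono (low-at-same-depth (trans du (sym dv)) lu) lu (ℕₚ.<⇒≤ v<u)
    ... | inj₂ hu = high-parent-mono (λ lv → hu (low-at-same-depth (trans dv (sym du)) lv)) hu ¬rv ¬ru
                                     (ℕₚ.<⇒≤ v<u)
    same-length : length (path (parent u)) ≡ length (path (parent v))
    same-length = trans (path-length _) (trans (cong suc (trans dpu (sym dpv))) (sym (path-length _)))
    extended : path (parent u) ∷ʳ code u <ₗ path (parent v) ∷ʳ code v
    extended with ℕₚ.m≤n⇒m<n∨m≡n pv≤pu
    ... | inj₁ pv<pu = ∷ʳ-<ₗ-mono _ _ same-length (path-antitone k dpu dpv pv<pu)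
    ... | inj₂ e rewrite x-inj e = ∷ʳ-<ₗ-last (path (parent u)) (code-< v<u)

  path-antitone⁻¹ : ∀ {u v} → depth u ≡ depth v → path u <ₗ path v → x v ≤ x u
  path-antitone⁻¹ {u} {v} e p with x u <? x v
  ... | yes u<v = contradiction (path-antitone (depth v) refl e u<v) (<ₗ-asym p)
  ... | no u≮v = ℕₚ.≮⇒≥ u≮v

  -- The word lists the vertices in path order; each tree gets its own block
  -- of M letters, and within the block the letter of a vertex is its depth.
  M : ℕ
  M = suc (n + n)

  letter : Fin n → ℕ
  letter v = depth v + M * rootPos v

  open Sorting <ₗ-isStrictTotalOrder path path-inj public using (σ; σ-mono; σ-reflects; σ↔)

  infix 4 _⟶_
  _⟶_ : Fin n → Fin n → Set
  u ⟶ v = toℕ (σ u) < toℕ (σ v) × letter v ≡ suc (letter u)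

  path-before-child : ∀ {u v} → depth v ≡ suc (depth u) → ¬ Root v → x (parent v) ≤ x u →
                      path u <ₗ path v
  path-before-child {u} {v} dv ¬rv pv≤u rewrite path-nonroot ¬rv with ℕₚ.m≤n⇒m<n∨m≡n pv≤u
  ... | inj₁ pv<u = <ₗ-trans (path-antitone (depth u) refl dpv pv<u) (<ₗ-∷ʳ _ _)
    where
    dpv : depth (parent v) ≡ depth u
    dpv = ℕₚ.suc-injective (trans (sym (depth-nonroot ¬rv)) dv)
  ... | inj₂ e rewrite x-inj e = <ₗ-∷ʳ _ _

  tree-arc : ∀ {u v} → rootPos u ≡ rootPos v → depth v ≡ suc (depth u) → path u <ₗ path v → u ⟶ v
  tree-arc same dv p = σ-mono p , cong₂ _+_ dv (cong (M *_) (sym same))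

  inversion⇒arc : ∀ {a b} → a ↘ b → a ⟶ b ⊎ b ⟶ a
  inversion⇒arc {a} {b} a↘b with inversion-in-tree a↘b
  ... | same , inj₁ db = inj₁ (tree-arc same db
          (path-before-child db (low-nonroot (a , a↘b)) (parent-leftmost a (inj₁ a↘b))))
  ... | same , inj₂ da = inj₂ (tree-arc (sym same) da
          (path-before-child da (nonroot-of-depth da) (parent-leftmost b (inj₂ a↘b))))

  -- Conversely, consecutive depths of one tree in path order are adjacent:
  -- path order places u at or after parent v, and then the monotonicity
  -- lemmas produce the inversion.
  tree-arc⁻¹ : ∀ {u v} → rootPos u ≡ rootPos v → depth v ≡ suc (depth u) → path u <ₗ path v → u ~ v
  tree-arc⁻¹ {u} {v} same dv p =
    by-parent-order (<ₗ-∷ʳ⁻¹ (code v) same-length (subst (path u <ₗ_) (path-nonroot ¬rv) p))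
    where
    ¬rv : ¬ Root v
    ¬rv = nonroot-of-depth dv
    du : depth u ≡ depth (parent v)
    du = ℕₚ.suc-injective (trans (sym dv) (depth-nonroot ¬rv))
    same-length : length (path u) ≡ length (path (parent v))
    same-length = trans (path-length u) (trans (cong suc du) (sym (path-length _)))
    by-parent-order : path u ≡ path (parent v) ⊎ path u <ₗ path (parent v) → u ~ v
    by-parent-order (inj₁ e) rewrite path-inj e = parent-adjacent (proj₂ (nonroot-adjacent ¬rv))
    by-parent-order (inj₂ q) with low-or-high u
    ... | inj₂ hu = inj₁ (high-at-parent-depth-left lv hu same du ,
                          ℕₚ.<-≤-trans (proj₂ (parent-of-low lv))
                            (high-increasing≤ (low-parent-high lv) hu (path-antitone⁻¹ du q)))
      where
      lv : Low v
      lv = low-below-high dv hu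
    ... | inj₁ lu = inj₂ (ℕₚ.<-≤-trans (proj₁ (parent-of-high hv ¬rv)) (path-antitone⁻¹ du q) ,
                          low-at-parent-depth-below hv ¬rv lu same du)
      where
      hv : High v
      hv = high-below-low dv lu

  -- An arc of the word joins consecutive depths of one tree, by the block
  -- structure of the letters.
  arc⇒adjacent : ∀ {u v} → u ⟶ v → u ~ v
  arc⇒adjacent {u} {v} (σu<σv , next-letter) = tree-arc⁻¹ same-root dv (σ-reflects σu<σv)
    where
    same-root : rootPos u ≡ rootPos v
    same-root = successor-same-block M (s≤s (depth<2n u)) (ℕₚ.≤-trans (depth<2n v) (ℕₚ.n≤1+n _)) next-letter
    dv : depth v ≡ suc (depth u)
    dv = ℕₚ.+-cancelʳ-≡ (M * rootPos v) (depth v) (suc (depth u))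
           (trans next-letter (cong (λ r → suc (depth u + M * r)) same-root))

  adjacent⇔arc : ∀ u v → u ~ v ⇔ (u ⟶ v ⊎ v ⟶ u)
  adjacent⇔arc u v = mk⇔ to from
    where
    to : u ~ v → u ⟶ v ⊎ v ⟶ u
    to (inj₁ u↘v) = inversion⇒arc u↘v
    to (inj₂ v↘u) = Sum.swap (inversion⇒arc v↘u)
    from : u ⟶ v ⊎ v ⟶ u → u ~ v
    from (inj₁ arc) = arc⇒adjacent arc
    from (inj₂ arc) = ~-sym (arc⇒adjacent arc)

  alphabet : ℕ
  alphabet = M + M * n

  letter<alphabet : ∀ v → letter v < alphabet
  letter<alphabet v = ℕₚ.+-mono-<-≤ (ℕₚ.≤-trans (depth<2n v) (ℕₚ.n≤1+n _))
                        (ℕₚ.*-monoʳ-≤ M (ℕₚ.<⇒≤ (Finₚ.toℕ<n _)))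

  abstract
    word : Word alphabet n
    word p = fromℕ< (letter<alphabet (Inverse.from σ↔ p))

    word-σ : ∀ v → toℕ (word (σ v)) ≡ letter v
    word-σ v = trans (Finₚ.toℕ-fromℕ< _) (cong letter (Inverse.strictlyInverseʳ σ↔ v))

  inversion-graph-parikh : ∀ u v → u ~ v ⇔ ParikhAdj word (σ u) (σ v)
  inversion-graph-parikh u v rewrite word-σ u | word-σ v = adjacent⇔arc u v

no-three-colours : (a b c : Bool) → a ≢ b → b ≢ c → a ≢ c → ⊥
no-three-colours false false _     a≢b _   _   = a≢b refl
no-three-colours true  true  _     a≢b _   _   = a≢b refl
no-three-colours false true  false _   _   a≢c = a≢c refl
no-three-colours false true  true  _   b≢c _   = b≢c refl
no-three-colours true  false false _   b≢c _   = b≢c refl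
no-three-colours true  false true  _   _   a≢c = a≢c refl

heights : (G : Graph) → PermutationGraph G → Fin (size G) → ℕ
heights G (_ , τ , _) i = toℕ (Inverse.to τ i)

heights-inj : (G : Graph) (pg : PermutationGraph G) → ∀ {i j} → heights G pg i ≡ heights G pg j → i ≡ j
heights-inj G (_ , τ , _) {i} {j} e = begin
  i                                  ≡⟨ ≡.sym (Inverse.strictlyInverseʳ τ i) ⟩
  Inverse.from τ (Inverse.to τ i)    ≡⟨ cong (Inverse.from τ) (Finₚ.toℕ-injective e) ⟩
  Inverse.from τ (Inverse.to τ j)    ≡⟨ Inverse.strictlyInverseʳ τ j ⟩
  j                                  ∎
  where open ≡.≡-Reasoning

permutation-adjacency : (G : Graph) (pg : PermutationGraph G) → ∀ i j →
  Adj G (Inverse.to (proj₁ pg) i) (Inverse.to (proj₁ pg) j) ⇔ InversionAdj (heights G pg) i j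
permutation-adjacency G (order , τ , represents) i j with ℕₚ.<-cmp (toℕ i) (toℕ j)
... | tri< i<j _ _ = mk⇔ (λ a → inj₁ (i<j , Equivalence.to (represents i j i<j) a))
  λ { (inj₁ (_ , τj<τi)) → Equivalence.from (represents i j i<j) τj<τi
    ; (inj₂ (j<i , _)) → contradiction j<i (ℕₚ.<-asym i<j) }
... | tri≈ _ i≡j _ rewrite Finₚ.toℕ-injective i≡j = mk⇔ (λ a → contradiction a (irrefl G))
  λ { (inj₁ (i<i , _)) → contradiction i<i (ℕₚ.<-irrefl refl)
    ; (inj₂ (i<i , _)) → contradiction i<i (ℕₚ.<-irrefl refl) }
... | tri> _ _ j<i = mk⇔ (λ a → inj₂ (j<i , Equivalence.to (represents j i j<i) (Graph.sym G a)))
  λ { (inj₁ (i<j , _)) → contradiction i<j (ℕₚ.<-asym j<i)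
    ; (inj₂ (_ , τi<τj)) → Graph.sym G (Equivalence.from (represents j i j<i) τi<τj) }

-- A decreasing triple of heights would be a triangle, which a bipartite
-- graph cannot contain.
bipartite-no-321 : (G : Graph) (pg : PermutationGraph G) → Bipartite G → No321 (heights G pg)
bipartite-no-321 G pg@(order , _ , _) (colour , proper) {u} {v} {w} u↘v v↘w =
  no-three-colours (colour (vertex u)) (colour (vertex v)) (colour (vertex w))
    (proper _ _ (edge u↘v)) (proper _ _ (edge v↘w))
    (proper _ _ (edge (ℕₚ.<-trans (proj₁ u↘v) (proj₁ v↘w) , ℕₚ.<-trans (proj₂ v↘w) (proj₂ u↘v))))
  where
  vertex : Fin (size G) → Fin (size G)
  vertex = Inverse.to order
  edge : ∀ {i j} → Inversion (heights G pg) i j → Adj G (vertex i) (vertex j)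
  edge {i} {j} i↘j = Equivalence.from (permutation-adjacency G pg i j) (inj₁ i↘j)

permutation-adjacency-by-vertex : (G : Graph) (pg : PermutationGraph G) → ∀ u u' →
  Adj G u u' ⇔ InversionAdj (heights G pg) (Inverse.from (proj₁ pg) u) (Inverse.from (proj₁ pg) u')
permutation-adjacency-by-vertex G pg@(order , _ , _) u u' =
  subst₂ (λ a b → Adj G a b ⇔ InversionAdj (heights G pg) (Inverse.from order u) (Inverse.from order u'))
         (Inverse.strictlyInverseˡ order u) (Inverse.strictlyInverseˡ order u')
         (permutation-adjacency G pg (Inverse.from order u) (Inverse.from order u'))

nonempty-representable : (G : Graph) → ∀ {s m} (w : Word s m) → 0 < m → G ≅ ParikhGraph w →
                         ParikhRepresentable G
nonempty-representable G {s} {suc m} w _ iso = s , m , w , iso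

theorem4p7 : (G : Graph) → 0 < size G → BipartitePermutationGraph G → ParikhRepresentable G
theorem4p7 G nonempty (bipartite , pg) =
  nonempty-representable G word nonempty (σ↔ ↔-∘ ↔-sym ordering , preserves)
  where
  ordering : Fin (size G) ↔ Fin (size G)
  ordering = proj₁ pg
  open InversionGraph (heights G pg) (heights-inj G pg) (bipartite-no-321 G pg bipartite)
  preserves : ∀ u u' → Adj G u u' ⇔ ParikhAdj word (σ (Inverse.from ordering u)) (σ (Inverse.from ordering u'))
  preserves u u' = inversion-graph-parikh _ _ ⇔-∘ permutation-adjacency-by-vertex G pg u u'
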